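{- Let $s\ge 4$ and let $S_1,\dots,S_t$ be the blocks of an $(n,s,2)$-Steiner system on ground set $V$. Let $G$ be the $4$-uniform hypergraph on vertex set $V$ obtained by placing a complete $4$-uniform hypergraph on each $S_i$. Then $e(G)=\Theta(n^2s^2)$ and $\mathrm{surp}(G)=O(n^2+ns^2)$. In particular, when $s=\Theta(\sqrt n)$, we have $\mathrm{surp}(G)=O(e(G)^{2/3})$.
   Context: An $(n,s,2)$-Steiner system is an $n$-element set $V$ with a family of $s$-element subsets (blocks) such that each pair of elements of $V$ lies in exactly one block. A $2$-cut of a hypergraph is a partition of its vertex set into two parts; its size is the number of edges meeting both parts. For a $4$-uniform hypergraph $G$ with $m$ edges, $\mathrm{surp}(G)$ is the maximum size of a $2$-cut minus $\frac{7}{8}m$ (the expected size of a uniformly random $2$-cut). -}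

module Defs where

open import Data.Nat using (ℕ; zero; suc; _⊔_; _*_)
open import Data.Nat.Properties using (_≟_)
open import Data.Integer using (+_) renaming (_-_ to _-ℤ_)
open import Data.Rational using (ℚ; _/_)
open import Data.Fin using (Fin)
open import Data.Fin.Properties using (any?)
open import Data.Fin.Subset using (Subset; _∈_; _⊆_; _∩_; ∁; ∣_∣; Nonempty)
open import Data.Fin.Subset.Properties using (_∈?_; _⊆?_; nonempty?)
open import Data.Vec using ([]; _∷_)
open import Data.List using (List; []; _∷_; _++_; map; filter; length; foldr; allFin)
open import Data.Product using (_×_; ∃)
open import Relation.Nullary using (Dec)
open import Relation.Nullary.Decidable using (_×-dec_)
open import Relation.Binary.PropositionalEquality using (_≡_; _≢_)

count : ∀ {t} {P : Fin t → Set} → (∀ i → Dec (P i)) → ℕ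
count {t} P? = length (filter P? (allFin t))

allSubsets : ∀ n → List (Subset n)
allSubsets zero    = [] ∷ []
allSubsets (suc n) = map (Data.Bool.true ∷_) (allSubsets n) ++ map (Data.Bool.false ∷_) (allSubsets n)
  where import Data.Bool

IsSteinerSystem : (n s t : ℕ) → (Fin t → Subset n) → Set
IsSteinerSystem n s t B =
  (∀ i → ∣ B i ∣ ≡ s) ×
  (∀ (x y : Fin n) → x ≢ y → count (λ i → (x ∈? B i) ×-dec (y ∈? B i)) ≡ 1)

IsEdge : ∀ {n t} → (Fin t → Subset n) → Subset n → Set
IsEdge B e = (∣ e ∣ ≡ 4) × ∃ (λ i → e ⊆ B i)

isEdge? : ∀ {n t} (B : Fin t → Subset n) (e : Subset n) → Dec (IsEdge B e)
isEdge? B e = (∣ e ∣ ≟ 4) ×-dec any? (λ i → e ⊆? B i)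

edges : ∀ {n t} → (Fin t → Subset n) → List (Subset n)
edges {n} B = filter (isEdge? B) (allSubsets n)

numEdges : ∀ {n t} → (Fin t → Subset n) → ℕ
numEdges B = length (edges B)

cutSize : ∀ {n t} → (Fin t → Subset n) → Subset n → ℕ
cutSize B P = length (filter (λ e → nonempty? (e ∩ P) ×-dec nonempty? (e ∩ ∁ P)) (edges B))

maxCut : ∀ {n t} → (Fin t → Subset n) → ℕ
maxCut {n} B = foldr _⊔_ 0 (map (cutSize B) (allSubsets n))

surp : ∀ {n t} → (Fin t → Subset n) → ℚ
surp B = ((+ (8 * maxCut B)) -ℤ (+ (7 * numEdges B))) / 8

{-# OPTIONS --safe #-}
-- A block of size s = a + b split by a cut (P, V ∖ P) contains C(s,4) − C(a,4) − C(b,4) cut edges, and a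
-- polynomial identity, whose slack is a square, gives
--   14·C(s,4) ≤ 16·(C(a,4) + C(b,4)) + 2(s−2)(s−3)·ab + C(s,2).
-- Summing over the blocks, the Steiner property turns Σ ab into |P|·|V ∖ P| ≤ n²/4 and Σ C(s,2) into
-- C(n,2), while 12·e(G) = C(n,2)(s−2)(s−3); together 32·cut ≤ 28·e(G) + n² + ns², that is,
-- surp(G) ≤ (n² + ns²)/32. The formula for e(G) also gives e(G) = Θ(n²s²), and when s² = Θ(n) we
-- have surp(G) = O(n²) and e(G) = Ω(n³), whence surp(G)³ = O(e(G)²).
module Submission where

module Sums where

  open import Data.Bool using (true; false; if_then_else_)
  open import Data.Nat
  open import Data.Nat.Properties
  open import Data.Fin using (Fin; zero; suc)
  open import Data.Fin.Properties using (any?)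
  open import Data.Fin.Subset using (Subset)
  open import Data.Vec using ([]; _∷_)
  open import Data.List using (List; []; _∷_; _++_; map; filter; length; tabulate)
  open import Data.List.Properties using (length-++; filter-++)
  open import Function using (_∘_; id)
  open import Relation.Nullary using (Dec; yes; no; does; contradiction)
  open import Relation.Nullary.Decidable using (_×-dec_)
  open import Relation.Unary using (Decidable)
  open import Relation.Binary.PropositionalEquality
  open import Algebra.Properties.Semiring.Sum +-*-semiring using (sum-syntax; ∑-distrib-+)
  open import Algebra.Properties.CommutativeSemigroup +-commutativeSemigroup using (interchange)
  open import Defs using (count; allSubsets)

  private variable
    A P Q : Set

  𝟙 : Dec P → ℕ
  𝟙 d = if does d then 1 else 0

  𝟙-cong : (P? : Dec P) (Q? : Dec Q) → (P → Q) → (Q → P) → 𝟙 P? ≡ 𝟙 Q?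
  𝟙-cong (yes _) (yes _) _   _   = refl
  𝟙-cong (yes p) (no ¬q) p→q _   = contradiction (p→q p) ¬q
  𝟙-cong (no ¬p) (yes q) _   q→p = contradiction (q→p q) ¬p
  𝟙-cong (no _)  (no _)  _   _   = refl

  𝟙-mono : (P? : Dec P) (Q? : Dec Q) → (P → Q) → 𝟙 P? ≤ 𝟙 Q?
  𝟙-mono (yes p) (yes _) _   = ≤-refl
  𝟙-mono (yes p) (no ¬q) p→q = contradiction (p→q p) ¬q
  𝟙-mono (no _)  _       _   = z≤n

  𝟙-× : (P? : Dec P) (Q? : Dec Q) → 𝟙 (P? ×-dec Q?) ≡ 𝟙 P? * 𝟙 Q?
  𝟙-× (yes _) (yes _) = refl
  𝟙-× (yes _) (no _)  = refl
  𝟙-× (no _)  _       = refl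

  ∑-mono-≤ : ∀ {t} {f g : Fin t → ℕ} → (∀ i → f i ≤ g i) → ∑[ i < t ] f i ≤ ∑[ i < t ] g i
  ∑-mono-≤ {zero}  f≤g = z≤n
  ∑-mono-≤ {suc t} f≤g = +-mono-≤ (f≤g zero) (∑-mono-≤ (f≤g ∘ suc))

  ∑-const : ∀ t c → ∑[ i < t ] c ≡ t * c
  ∑-const zero    c = refl
  ∑-const (suc t) c = cong (c +_) (∑-const t c)

  length-filter-tabulate : ∀ {t} {P : A → Set} (P? : Decidable P) (f : Fin t → A) →
    length (filter P? (tabulate f)) ≡ ∑[ i < t ] 𝟙 (P? (f i))
  length-filter-tabulate {t = zero}  P? f = refl
  length-filter-tabulate {t = suc t} P? f with does (P? (f zero))
  ... | true  = cong suc (length-filter-tabulate P? (f ∘ suc))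
  ... | false = length-filter-tabulate P? (f ∘ suc)

  count≡∑ : ∀ {t} {P : Fin t → Set} (P? : ∀ i → Dec (P i)) → count P? ≡ ∑[ i < t ] 𝟙 (P? i)
  count≡∑ P? = length-filter-tabulate P? id

  ∑ˢ : ∀ {n} → (Subset n → ℕ) → ℕ
  ∑ˢ {zero}  f = f []
  ∑ˢ {suc n} f = ∑ˢ (f ∘ (true ∷_)) + ∑ˢ (f ∘ (false ∷_))

  ∑ˢ-cong : ∀ {n} {f g : Subset n → ℕ} → (∀ e → f e ≡ g e) → ∑ˢ f ≡ ∑ˢ g
  ∑ˢ-cong {zero}  f≡g = f≡g []
  ∑ˢ-cong {suc n} f≡g = cong₂ _+_ (∑ˢ-cong (f≡g ∘ (true ∷_))) (∑ˢ-cong (f≡g ∘ (false ∷_)))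

  ∑ˢ-zero : ∀ n → ∑ˢ {n} (λ _ → 0) ≡ 0
  ∑ˢ-zero zero    = refl
  ∑ˢ-zero (suc n) = cong₂ _+_ (∑ˢ-zero n) (∑ˢ-zero n)

  ∑ˢ-∑-comm : ∀ {n t} (f : Fin t → Subset n → ℕ) → ∑ˢ (λ e → ∑[ i < t ] f i e) ≡ ∑[ i < t ] ∑ˢ (f i)
  ∑ˢ-∑-comm {zero}  f = refl
  ∑ˢ-∑-comm {suc n} f = begin
    ∑ˢ (λ e → ∑[ i < _ ] f i (true ∷ e)) + ∑ˢ (λ e → ∑[ i < _ ] f i (false ∷ e))
      ≡⟨ cong₂ _+_ (∑ˢ-∑-comm (λ i → f i ∘ (true ∷_))) (∑ˢ-∑-comm (λ i → f i ∘ (false ∷_))) ⟩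
    ∑[ i < _ ] ∑ˢ (f i ∘ (true ∷_)) + ∑[ i < _ ] ∑ˢ (f i ∘ (false ∷_))
      ≡⟨ ∑-distrib-+ (λ i → ∑ˢ (f i ∘ (true ∷_))) (λ i → ∑ˢ (f i ∘ (false ∷_))) ⟨
    ∑[ i < _ ] ∑ˢ (f i) ∎
    where open ≡-Reasoning

  length-filter-map : ∀ {B : Set} {P : B → Set} (P? : Decidable P) (f : A → B) xs →
    length (filter P? (map f xs)) ≡ length (filter (P? ∘ f) xs)
  length-filter-map P? f []       = refl
  length-filter-map P? f (x ∷ xs) with does (P? (f x))
  ... | true  = cong suc (length-filter-map P? f xs)
  ... | false = length-filter-map P? f xs

  length-filter-allSubsets : ∀ n {P : Subset n → Set} (P? : Decidable P) →
    length (filter P? (allSubsets n)) ≡ ∑ˢ (𝟙 ∘ P?)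
  length-filter-allSubsets zero    P? with does (P? [])
  ... | true  = refl
  ... | false = refl
  length-filter-allSubsets (suc n) P? = begin
    length (filter P? (map (true ∷_) S ++ map (false ∷_) S))
      ≡⟨ cong length (filter-++ P? (map (true ∷_) S) (map (false ∷_) S)) ⟩
    length (filter P? (map (true ∷_) S) ++ filter P? (map (false ∷_) S))
      ≡⟨ length-++ (filter P? (map (true ∷_) S)) ⟩
    length (filter P? (map (true ∷_) S)) + length (filter P? (map (false ∷_) S))
      ≡⟨ cong₂ _+_ (length-filter-map P? (true ∷_) S) (length-filter-map P? (false ∷_) S) ⟩
    length (filter (P? ∘ (true ∷_)) S) + length (filter (P? ∘ (false ∷_)) S)
      ≡⟨ cong₂ _+_ (length-filter-allSubsets n (P? ∘ (true ∷_))) (length-filter-allSubsets n (P? ∘ (false ∷_))) ⟩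
    ∑ˢ (𝟙 ∘ P?) ∎
    where open ≡-Reasoning
          S : List (Subset n)
          S = allSubsets n

  length-filter-filter : ∀ {P Q : A → Set} (P? : Decidable P) (Q? : Decidable Q) xs →
    length (filter Q? (filter P? xs)) ≡ length (filter (λ x → P? x ×-dec Q? x) xs)
  length-filter-filter P? Q? []       = refl
  length-filter-filter P? Q? (x ∷ xs) with does (P? x)
  ... | false = length-filter-filter P? Q? xs
  ... | true with does (Q? x)
  ...   | true  = cong suc (length-filter-filter P? Q? xs)
  ...   | false = length-filter-filter P? Q? xs

  ∑ˢ-distrib-+ : ∀ {n} (f g : Subset n → ℕ) → ∑ˢ (λ e → f e + g e) ≡ ∑ˢ f + ∑ˢ g
  ∑ˢ-distrib-+ {zero}  f g = refl
  ∑ˢ-distrib-+ {suc n} f g = begin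
    ∑ˢ (λ e → f (true ∷ e) + g (true ∷ e)) + ∑ˢ (λ e → f (false ∷ e) + g (false ∷ e))
      ≡⟨ cong₂ _+_ (∑ˢ-distrib-+ (f ∘ (true ∷_)) (g ∘ (true ∷_))) (∑ˢ-distrib-+ (f ∘ (false ∷_)) (g ∘ (false ∷_))) ⟩
    (∑ˢ (f ∘ (true ∷_)) + ∑ˢ (g ∘ (true ∷_))) + (∑ˢ (f ∘ (false ∷_)) + ∑ˢ (g ∘ (false ∷_)))
      ≡⟨ interchange (∑ˢ (f ∘ (true ∷_))) _ _ _ ⟩
    ∑ˢ f + ∑ˢ g ∎
    where open ≡-Reasoning

  𝟙-any : ∀ {t} {P : Fin t → Set} (P? : ∀ i → Dec (P i)) →
    ∑[ i < t ] 𝟙 (P? i) ≤ 1 → 𝟙 (any? P?) ≡ ∑[ i < t ] 𝟙 (P? i)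
  𝟙-any {zero}  P? _ = refl
  𝟙-any {suc t} P? ≤1 with P? zero
  ... | yes _ = cong suc (sym (n≤0⇒n≡0 (s≤s⁻¹ ≤1)))
  ... | no  _ = 𝟙-any (P? ∘ suc) ≤1

  𝟙-yes : (P? : Dec P) → P → 𝟙 P? ≡ 1
  𝟙-yes (yes _) _ = refl
  𝟙-yes (no ¬p) p = contradiction p ¬p

  𝟙-*-cong : (P? : Dec P) {x y : ℕ} → (P → x ≡ y) → 𝟙 P? * x ≡ 𝟙 P? * y
  𝟙-*-cong (yes p) x≡y = cong (1 *_) (x≡y p)
  𝟙-*-cong (no _)  _   = refl

module Subsets where

  open import Data.Nat hiding (∣_-_∣)
  open import Data.Nat.Properties
  open import Data.Nat.Combinatorics using (_C_; nCk+nC[k+1]≡[n+1]C[k+1])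
  open import Data.Fin using (zero; suc) renaming (_≟_ to _≟ᶠ_)
  open import Data.Fin.Properties using () renaming (suc-injective to Fin-suc-injective)
  open import Data.Fin.Subset
  open import Data.Fin.Subset.Properties
  open import Data.Vec using ([]; _∷_; here; there)
  open import Data.Product using (_×_; _,_; ∃₂)
  open import Data.Sum using (_⊎_; inj₁; inj₂)
  open import Function using (_∘_)
  open import Relation.Nullary using (yes; no; contradiction; ¬?)
  open import Relation.Nullary.Decidable using (_×-dec_)
  open import Relation.Binary.PropositionalEquality
  open Sums

  subsets-of-size≡C : ∀ {n} (a : Subset n) k → ∑ˢ (λ e → 𝟙 (e ⊆? a) * 𝟙 (∣ e ∣ ≟ k)) ≡ ∣ a ∣ C k
  subsets-of-size≡C []           zero    = refl
  subsets-of-size≡C []           (suc k) = refl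
  subsets-of-size≡C {suc n} (inside ∷ a) zero =
    cong₂ _+_ (trans (∑ˢ-cong (λ e → *-zeroʳ (𝟙 (e ⊆? a)))) (∑ˢ-zero n)) (subsets-of-size≡C a zero)
  subsets-of-size≡C (inside ∷ a) (suc k) =
    trans (cong₂ _+_ (subsets-of-size≡C a k) (subsets-of-size≡C a (suc k)))
          (nCk+nC[k+1]≡[n+1]C[k+1] ∣ a ∣ k)
  subsets-of-size≡C {suc n} (outside ∷ a) k = cong₂ _+_ (∑ˢ-zero n) (subsets-of-size≡C a k)

  0<∣p∣⇒nonempty : ∀ {n} (p : Subset n) → 0 < ∣ p ∣ → Nonempty p
  0<∣p∣⇒nonempty (inside ∷ p)  _ = zero , here
  0<∣p∣⇒nonempty (outside ∷ p) h with 0<∣p∣⇒nonempty p h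
  ... | x , x∈p = suc x , there x∈p

  1<∣p∣⇒two-elements : ∀ {n} (p : Subset n) → 1 < ∣ p ∣ → ∃₂ λ x y → x ≢ y × x ∈ p × y ∈ p
  1<∣p∣⇒two-elements (inside ∷ p) (s≤s h) with 0<∣p∣⇒nonempty p h
  ... | y , y∈p = zero , suc y , (λ ()) , here , there y∈p
  1<∣p∣⇒two-elements (outside ∷ p) h with 1<∣p∣⇒two-elements p h
  ... | x , y , x≢y , x∈p , y∈p = suc x , suc y , x≢y ∘ Fin-suc-injective , there x∈p , there y∈p

  -- Removing x and then y leaves a set of size 0 that would still contain z.
  ∣p∣≡2⇒pair : ∀ {n} {p : Subset n} {x y z} → ∣ p ∣ ≡ 2 → x ≢ y → x ∈ p → y ∈ p → z ∈ p → z ≡ x ⊎ z ≡ y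
  ∣p∣≡2⇒pair {p = p} {x} {y} {z} ∣p∣≡2 x≢y x∈p y∈p z∈p with z ≟ᶠ x | z ≟ᶠ y
  ... | yes z≡x | _       = inj₁ z≡x
  ... | no _    | yes z≡y = inj₂ z≡y
  ... | no z≢x  | no z≢y  =
    contradiction (≤-trans (s≤s 1≤∣p-x-y∣) ∣p-x-y∣<∣p-x∣) (<⇒≱ (subst (∣ p - x ∣ <_) ∣p∣≡2 ∣p-x∣<∣p∣))
    where
    ∣p-x∣<∣p∣ : ∣ p - x ∣ < ∣ p ∣
    ∣p-x∣<∣p∣ = x∈p⇒∣p-x∣<∣p∣ x∈p
    ∣p-x-y∣<∣p-x∣ : ∣ p - x - y ∣ < ∣ p - x ∣
    ∣p-x-y∣<∣p-x∣ = x∈p⇒∣p-x∣<∣p∣ (x∈p∧x≢y⇒x∈p-y y∈p (x≢y ∘ sym))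
    1≤∣p-x-y∣ : 1 ≤ ∣ p - x - y ∣
    1≤∣p-x-y∣ = subst (_≤ ∣ p - x - y ∣) (∣⁅x⁆∣≡1 z)
      (p⊆q⇒∣p∣≤∣q∣ λ w∈⁅z⁆ → subst (_∈ p - x - y) (sym (x∈⁅y⁆⇒x≡y z w∈⁅z⁆))
        (x∈p∧x≢y⇒x∈p-y (x∈p∧x≢y⇒x∈p-y z∈p z≢x) z≢y))

  ⊆⇒∩∁-empty : ∀ {n} {p q : Subset n} → p ⊆ q → Empty (p ∩ ∁ q)
  ⊆⇒∩∁-empty {p = p} {q} p⊆q (x , x∈p∩∁q) with x∈p∩q⁻ p (∁ q) x∈p∩∁q
  ... | x∈p , x∈∁q = x∈∁p⇒x∉p x∈∁q (p⊆q x∈p)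

  ∩∁-empty⇒⊆ : ∀ {n} {p q : Subset n} → Empty (p ∩ ∁ q) → p ⊆ q
  ∩∁-empty⇒⊆ {q = q} empty {x} x∈p with x ∈? q
  ... | yes x∈q = x∈q
  ... | no  x∉q = contradiction (x , x∈p∩q⁺ (x∈p , x∉p⇒x∈∁p x∉q)) empty

  ⊆∁⇒∩-empty : ∀ {n} {p q : Subset n} → p ⊆ ∁ q → Empty (p ∩ q)
  ⊆∁⇒∩-empty {p = p} {q} p⊆∁q (x , x∈p∩q) with x∈p∩q⁻ p q x∈p∩q
  ... | x∈p , x∈q = x∈∁p⇒x∉p (p⊆∁q x∈p) x∈q

  ∩-empty⇒⊆∁ : ∀ {n} {p q : Subset n} → Empty (p ∩ q) → p ⊆ ∁ q
  ∩-empty⇒⊆∁ empty x∈p = x∉p⇒x∈∁p λ x∈q → empty (_ , x∈p∩q⁺ (x∈p , x∈q))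

  ⊆-∩⁻ : ∀ {n} {e p q : Subset n} → e ⊆ p ∩ q → e ⊆ p × e ⊆ q
  ⊆-∩⁻ {p = p} {q} e⊆p∩q = p∩q⊆p p q ∘ e⊆p∩q , p∩q⊆q p q ∘ e⊆p∩q

  𝟙-⊆-∩ : ∀ {n} (e p q : Subset n) → 𝟙 (e ⊆? p ∩ q) ≡ 𝟙 (e ⊆? p) * 𝟙 (e ⊆? q)
  𝟙-⊆-∩ e p q = trans
    (𝟙-cong (e ⊆? p ∩ q) ((e ⊆? p) ×-dec (e ⊆? q)) ⊆-∩⁻ λ (e⊆p , e⊆q) x∈e → x∈p∩q⁺ (e⊆p x∈e , e⊆q x∈e))
    (𝟙-× (e ⊆? p) (e ⊆? q))

  cut-trichotomy : ∀ {n} (e p : Subset n) → Nonempty e →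
    𝟙 (nonempty? (e ∩ p) ×-dec nonempty? (e ∩ ∁ p)) + 𝟙 (e ⊆? p) + 𝟙 (e ⊆? ∁ p) ≡ 1
  cut-trichotomy e p (x , x∈e)
    rewrite 𝟙-cong (e ⊆? p) (¬? (nonempty? (e ∩ ∁ p))) ⊆⇒∩∁-empty ∩∁-empty⇒⊆
          | 𝟙-cong (e ⊆? ∁ p) (¬? (nonempty? (e ∩ p))) ⊆∁⇒∩-empty ∩-empty⇒⊆∁
    with nonempty? (e ∩ p) | nonempty? (e ∩ ∁ p)
  ... | yes _ | yes _ = refl
  ... | yes _ | no  _ = refl
  ... | no  _ | yes _ = refl
  ... | no ∩-empty | no ∩∁-empty with x ∈? p
  ...   | yes x∈p = contradiction (x , x∈p∩q⁺ (x∈e , x∈p)) ∩-empty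
  ...   | no  x∉p = contradiction (x , x∈p∩q⁺ (x∈e , x∉p⇒x∈∁p x∉p)) ∩∁-empty

  ∣p∩q∣+∣p∩∁q∣≡∣p∣ : ∀ {n} (p q : Subset n) → ∣ p ∩ q ∣ + ∣ p ∩ ∁ q ∣ ≡ ∣ p ∣
  ∣p∩q∣+∣p∩∁q∣≡∣p∣ []            []            = refl
  ∣p∩q∣+∣p∩∁q∣≡∣p∣ (inside  ∷ p) (inside  ∷ q) = cong suc (∣p∩q∣+∣p∩∁q∣≡∣p∣ p q)
  ∣p∩q∣+∣p∩∁q∣≡∣p∣ (inside  ∷ p) (outside ∷ q) = trans (+-suc _ _) (cong suc (∣p∩q∣+∣p∩∁q∣≡∣p∣ p q))
  ∣p∩q∣+∣p∩∁q∣≡∣p∣ (outside ∷ p) (_       ∷ q) = ∣p∩q∣+∣p∩∁q∣≡∣p∣ p q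

  ∣p∣+∣∁p∣≡n : ∀ {n} (p : Subset n) → ∣ p ∣ + ∣ ∁ p ∣ ≡ n
  ∣p∣+∣∁p∣≡n p = trans (cong (∣ p ∣ +_) (∣∁p∣≡n∸∣p∣ p)) (m+[n∸m]≡n (∣p∣≤n p))

module LinearSpaces where

  open import Data.Nat
  open import Data.Nat.Properties
  open import Data.Nat.Combinatorics using (_C_; nCk+nC[k+1]≡[n+1]C[k+1]; nC1≡n)
  open import Data.Nat.Tactic.RingSolver using (solve-∀)
  open import Data.Fin using (Fin)
  open import Data.Fin.Properties using (any?)
  open import Data.Fin.Subset
  open import Data.Fin.Subset.Properties
  open import Data.Product using (_×_; _,_)
  open import Data.Sum using (inj₁; inj₂)
  open import Relation.Nullary using (Dec)
  open import Relation.Nullary.Decidable using (_×-dec_)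
  open import Relation.Binary.PropositionalEquality
  open import Algebra.Properties.Semiring.Sum +-*-semiring
    using (sum-syntax; ∑-distrib-+; sum-cong-≗; *-distribˡ-sum)
  open import Defs
  open Sums
  open Subsets

  [m+n]C2≡mC2+nC2+m*n : ∀ m n → (m + n) C 2 ≡ m C 2 + n C 2 + m * n
  [m+n]C2≡mC2+nC2+m*n m zero    = trans (cong (_C 2) (+-identityʳ m)) (pad (m C 2) m)
    where pad : ∀ x m → x ≡ x + 0 + m * 0
          pad = solve-∀
  [m+n]C2≡mC2+nC2+m*n m (suc n) = begin
    (m + suc n) C 2                   ≡⟨ cong (_C 2) (+-suc m n) ⟩
    suc (m + n) C 2                   ≡⟨ nCk+nC[k+1]≡[n+1]C[k+1] (m + n) 1 ⟨
    (m + n) C 1 + (m + n) C 2         ≡⟨ cong₂ _+_ (nC1≡n (m + n)) ([m+n]C2≡mC2+nC2+m*n m n) ⟩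
    (m + n) + (m C 2 + n C 2 + m * n) ≡⟨ rearrange m n (m C 2) (n C 2) ⟩
    m C 2 + (n + n C 2) + m * suc n   ≡⟨ cong (λ x → m C 2 + x + m * suc n) pascal ⟩
    m C 2 + suc n C 2 + m * suc n     ∎
    where
    open ≡-Reasoning
    rearrange : ∀ m n x y → (m + n) + (x + y + m * n) ≡ x + (n + y) + m * suc n
    rearrange = solve-∀
    pascal : n + n C 2 ≡ suc n C 2
    pascal = trans (cong (_+ n C 2) (sym (nC1≡n n))) (nCk+nC[k+1]≡[n+1]C[k+1] n 1)

  module LinearSpace {n t} (B : Fin t → Subset n)
    (pair-in-one-block : ∀ (x y : Fin n) → x ≢ y → count (λ i → (x ∈? B i) ×-dec (y ∈? B i)) ≡ 1) where

    blocks⊇ : Subset n → ℕ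
    blocks⊇ e = ∑[ i < t ] 𝟙 (e ⊆? B i)

    private
      blocks∋-pair : ∀ {x y} → x ≢ y → ∑[ i < t ] 𝟙 ((x ∈? B i) ×-dec (y ∈? B i)) ≡ 1
      blocks∋-pair {x} {y} x≢y = trans (sym (count≡∑ (λ i → (x ∈? B i) ×-dec (y ∈? B i)))) (pair-in-one-block x y x≢y)

    blocks⊇≤1 : ∀ e → 1 < ∣ e ∣ → blocks⊇ e ≤ 1
    blocks⊇≤1 e 1<∣e∣ with 1<∣p∣⇒two-elements e 1<∣e∣
    ... | x , y , x≢y , x∈e , y∈e = begin
      blocks⊇ e                                   ≤⟨ ∑-mono-≤ (λ i → 𝟙-mono (e ⊆? B i) ((x ∈? B i) ×-dec (y ∈? B i))
                                                                         λ e⊆B → e⊆B x∈e , e⊆B y∈e) ⟩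
      ∑[ i < t ] 𝟙 ((x ∈? B i) ×-dec (y ∈? B i))  ≡⟨ blocks∋-pair x≢y ⟩
      1                                           ∎
      where open ≤-Reasoning

    blocks⊇≡1 : ∀ e → ∣ e ∣ ≡ 2 → blocks⊇ e ≡ 1
    blocks⊇≡1 e ∣e∣≡2 with 1<∣p∣⇒two-elements e (≤-reflexive (sym ∣e∣≡2))
    ... | x , y , x≢y , x∈e , y∈e =
      trans (sum-cong-≗ λ i → 𝟙-cong (e ⊆? B i) ((x ∈? B i) ×-dec (y ∈? B i)) (λ e⊆B → e⊆B x∈e , e⊆B y∈e) (pair⊆ (B i)))
            (blocks∋-pair x≢y)
      where
      pair⊆ : ∀ b → x ∈ b × y ∈ b → e ⊆ b
      pair⊆ b (x∈b , y∈b) z∈e with ∣p∣≡2⇒pair ∣e∣≡2 x≢y x∈e y∈e z∈e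
      ... | inj₁ refl = x∈b
      ... | inj₂ refl = y∈b

    ∑-subsets-in-blocks : ∀ a k →
      ∑ˢ (λ e → 𝟙 (e ⊆? a) * 𝟙 (∣ e ∣ ≟ k) * blocks⊇ e) ≡ ∑[ i < t ] (∣ B i ∩ a ∣ C k)
    ∑-subsets-in-blocks a k = begin
      ∑ˢ (λ e → 𝟙 (e ⊆? a) * 𝟙 (∣ e ∣ ≟ k) * blocks⊇ e)
        ≡⟨ ∑ˢ-cong (λ e → trans (*-distribˡ-sum (𝟙 (e ⊆? a) * 𝟙 (∣ e ∣ ≟ k)) (λ i → 𝟙 (e ⊆? B i)))
                                (sum-cong-≗ (restrict e))) ⟩
      ∑ˢ (λ e → ∑[ i < t ] (𝟙 (e ⊆? B i ∩ a) * 𝟙 (∣ e ∣ ≟ k)))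
        ≡⟨ ∑ˢ-∑-comm (λ i e → 𝟙 (e ⊆? B i ∩ a) * 𝟙 (∣ e ∣ ≟ k)) ⟩
      ∑[ i < t ] ∑ˢ (λ e → 𝟙 (e ⊆? B i ∩ a) * 𝟙 (∣ e ∣ ≟ k))
        ≡⟨ sum-cong-≗ (λ i → subsets-of-size≡C (B i ∩ a) k) ⟩
      ∑[ i < t ] (∣ B i ∩ a ∣ C k) ∎
      where
      open ≡-Reasoning
      swap : ∀ x y z → x * y * z ≡ z * x * y
      swap = solve-∀
      restrict : ∀ e i → 𝟙 (e ⊆? a) * 𝟙 (∣ e ∣ ≟ k) * 𝟙 (e ⊆? B i) ≡ 𝟙 (e ⊆? B i ∩ a) * 𝟙 (∣ e ∣ ≟ k)
      restrict e i = trans (swap (𝟙 (e ⊆? a)) (𝟙 (∣ e ∣ ≟ k)) (𝟙 (e ⊆? B i)))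
                           (cong (_* 𝟙 (∣ e ∣ ≟ k)) (sym (𝟙-⊆-∩ e (B i) a)))

    edges-within : ∀ a → ∑ˢ (λ e → 𝟙 (isEdge? B e) * 𝟙 (e ⊆? a)) ≡ ∑[ i < t ] (∣ B i ∩ a ∣ C 4)
    edges-within a = trans (∑ˢ-cong edge-count) (∑-subsets-in-blocks a 4)
      where
      edge-count : ∀ e → 𝟙 (isEdge? B e) * 𝟙 (e ⊆? a) ≡ 𝟙 (e ⊆? a) * 𝟙 (∣ e ∣ ≟ 4) * blocks⊇ e
      edge-count e = begin
        𝟙 (isEdge? B e) * 𝟙 (e ⊆? a)                ≡⟨ cong (_* 𝟙 (e ⊆? a)) (𝟙-× (∣ e ∣ ≟ 4) (any? λ i → e ⊆? B i)) ⟩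
        𝟙 (∣ e ∣ ≟ 4) * 𝟙 (any? λ i → e ⊆? B i) * 𝟙 (e ⊆? a) ≡⟨ *-assoc (𝟙 (∣ e ∣ ≟ 4)) _ _ ⟩
        𝟙 (∣ e ∣ ≟ 4) * (𝟙 (any? λ i → e ⊆? B i) * 𝟙 (e ⊆? a))
          ≡⟨ 𝟙-*-cong (∣ e ∣ ≟ 4) (λ ∣e∣≡4 → cong (_* 𝟙 (e ⊆? a))
               (𝟙-any (λ i → e ⊆? B i) (blocks⊇≤1 e (≤-trans (s≤s (s≤s z≤n)) (≤-reflexive (sym ∣e∣≡4)))))) ⟩
        𝟙 (∣ e ∣ ≟ 4) * (blocks⊇ e * 𝟙 (e ⊆? a))     ≡⟨ rotate (𝟙 (∣ e ∣ ≟ 4)) (blocks⊇ e) (𝟙 (e ⊆? a)) ⟩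
        𝟙 (e ⊆? a) * 𝟙 (∣ e ∣ ≟ 4) * blocks⊇ e      ∎
        where
        open ≡-Reasoning
        rotate : ∀ x y z → x * (y * z) ≡ z * x * y
        rotate = solve-∀

    pairs-within : ∀ a → ∑[ i < t ] (∣ B i ∩ a ∣ C 2) ≡ ∣ a ∣ C 2
    pairs-within a = begin
      ∑[ i < t ] (∣ B i ∩ a ∣ C 2)                         ≡⟨ ∑-subsets-in-blocks a 2 ⟨
      ∑ˢ (λ e → 𝟙 (e ⊆? a) * 𝟙 (∣ e ∣ ≟ 2) * blocks⊇ e) ≡⟨ ∑ˢ-cong pair-count ⟩
      ∑ˢ (λ e → 𝟙 (e ⊆? a) * 𝟙 (∣ e ∣ ≟ 2))             ≡⟨ subsets-of-size≡C a 2 ⟩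
      ∣ a ∣ C 2                                           ∎
      where
      open ≡-Reasoning
      pair-count : ∀ e → 𝟙 (e ⊆? a) * 𝟙 (∣ e ∣ ≟ 2) * blocks⊇ e ≡ 𝟙 (e ⊆? a) * 𝟙 (∣ e ∣ ≟ 2)
      pair-count e = trans (*-assoc (𝟙 (e ⊆? a)) _ _) (cong (𝟙 (e ⊆? a) *_)
        (trans (𝟙-*-cong (∣ e ∣ ≟ 2) (blocks⊇≡1 e)) (*-identityʳ _)))

    pairs-total : ∑[ i < t ] (∣ B i ∣ C 2) ≡ n C 2
    pairs-total = begin
      ∑[ i < t ] (∣ B i ∣ C 2)     ≡⟨ sum-cong-≗ (λ i → cong (λ b → ∣ b ∣ C 2) (∩-identityʳ (B i))) ⟨
      ∑[ i < t ] (∣ B i ∩ ⊤ ∣ C 2) ≡⟨ pairs-within (⊤ {n}) ⟩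
      ∣ ⊤ {n} ∣ C 2                ≡⟨ cong (_C 2) (∣⊤∣≡n n) ⟩
      n C 2                        ∎
      where open ≡-Reasoning

    numEdges≡∑ : numEdges B ≡ ∑[ i < t ] (∣ B i ∣ C 4)
    numEdges≡∑ = begin
      numEdges B                                      ≡⟨ length-filter-allSubsets n (isEdge? B) ⟩
      ∑ˢ (λ e → 𝟙 (isEdge? B e))                      ≡⟨ ∑ˢ-cong (λ e → trans (sym (*-identityʳ _))
                                                            (cong (𝟙 (isEdge? B e) *_) (sym (𝟙-yes (e ⊆? ⊤) ⊆⊤)))) ⟩
      ∑ˢ (λ e → 𝟙 (isEdge? B e) * 𝟙 (e ⊆? ⊤))        ≡⟨ edges-within (⊤ {n}) ⟩
      ∑[ i < t ] (∣ B i ∩ ⊤ ∣ C 4)                    ≡⟨ sum-cong-≗ (λ i → cong (λ b → ∣ b ∣ C 4) (∩-identityʳ (B i))) ⟩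
      ∑[ i < t ] (∣ B i ∣ C 4)                        ∎
      where open ≡-Reasoning

    cross-pairs : ∀ p → ∑[ i < t ] (∣ B i ∩ p ∣ * ∣ B i ∩ ∁ p ∣) ≡ ∣ p ∣ * ∣ ∁ p ∣
    cross-pairs p = +-cancelˡ-≡ (∣ p ∣ C 2 + ∣ ∁ p ∣ C 2) _ _ (begin
      ∣ p ∣ C 2 + ∣ ∁ p ∣ C 2 + ∑[ i < t ] (a i * b i)
        ≡⟨ cong (_+ ∑[ i < t ] (a i * b i)) (cong₂ _+_ (pairs-within p) (pairs-within (∁ p))) ⟨
      ∑[ i < t ] (a i C 2) + ∑[ i < t ] (b i C 2) + ∑[ i < t ] (a i * b i)
        ≡⟨ trans (∑-distrib-+ (λ i → a i C 2 + b i C 2) (λ i → a i * b i))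
                 (cong (_+ ∑[ i < t ] (a i * b i)) (∑-distrib-+ (λ i → a i C 2) (λ i → b i C 2))) ⟨
      ∑[ i < t ] (a i C 2 + b i C 2 + a i * b i)
        ≡⟨ sum-cong-≗ (λ i → [m+n]C2≡mC2+nC2+m*n (a i) (b i)) ⟨
      ∑[ i < t ] ((a i + b i) C 2)
        ≡⟨ sum-cong-≗ (λ i → cong (_C 2) (∣p∩q∣+∣p∩∁q∣≡∣p∣ (B i) p)) ⟩
      ∑[ i < t ] (∣ B i ∣ C 2)
        ≡⟨ pairs-total ⟩
      n C 2
        ≡⟨ cong (_C 2) (∣p∣+∣∁p∣≡n p) ⟨
      (∣ p ∣ + ∣ ∁ p ∣) C 2
        ≡⟨ [m+n]C2≡mC2+nC2+m*n ∣ p ∣ ∣ ∁ p ∣ ⟩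
      ∣ p ∣ C 2 + ∣ ∁ p ∣ C 2 + ∣ p ∣ * ∣ ∁ p ∣ ∎)
      where
      open ≡-Reasoning
      a b : Fin t → ℕ
      a i = ∣ B i ∩ p ∣
      b i = ∣ B i ∩ ∁ p ∣

    cut-decomposition : ∀ p →
      cutSize B p + ∑[ i < t ] (∣ B i ∩ p ∣ C 4 + ∣ B i ∩ ∁ p ∣ C 4) ≡ numEdges B
    cut-decomposition p = begin
      cutSize B p + ∑[ i < t ] (∣ B i ∩ p ∣ C 4 + ∣ B i ∩ ∁ p ∣ C 4)
        ≡⟨ cong₂ _+_ cutSize≡ (trans (∑-distrib-+ (λ i → ∣ B i ∩ p ∣ C 4) (λ i → ∣ B i ∩ ∁ p ∣ C 4))
                                     (sym (cong₂ _+_ (edges-within p) (edges-within (∁ p))))) ⟩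
      ∑ˢ (λ e → E e * cut e) + (∑ˢ (λ e → E e * 𝟙 (e ⊆? p)) + ∑ˢ (λ e → E e * 𝟙 (e ⊆? ∁ p)))
        ≡⟨ trans (∑ˢ-distrib-+ (λ e → E e * cut e) _)
                 (cong (∑ˢ (λ e → E e * cut e) +_) (∑ˢ-distrib-+ (λ e → E e * 𝟙 (e ⊆? p)) _)) ⟨
      ∑ˢ (λ e → E e * cut e + (E e * 𝟙 (e ⊆? p) + E e * 𝟙 (e ⊆? ∁ p)))
        ≡⟨ ∑ˢ-cong edge-counted-once ⟩
      ∑ˢ E
        ≡⟨ length-filter-allSubsets n (isEdge? B) ⟨
      numEdges B ∎
      where
      open ≡-Reasoning
      cut? : (e : Subset n) → Dec (Nonempty (e ∩ p) × Nonempty (e ∩ ∁ p))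
      cut? e = nonempty? (e ∩ p) ×-dec nonempty? (e ∩ ∁ p)
      E cut : Subset n → ℕ
      E e = 𝟙 (isEdge? B e)
      cut e = 𝟙 (cut? e)
      cutSize≡ : cutSize B p ≡ ∑ˢ (λ e → E e * cut e)
      cutSize≡ = trans (length-filter-filter (isEdge? B) cut? (allSubsets n))
        (trans (length-filter-allSubsets n (λ e → isEdge? B e ×-dec cut? e)) (∑ˢ-cong λ e → 𝟙-× (isEdge? B e) (cut? e)))
      factor : ∀ x c y z → x * c + (x * y + x * z) ≡ x * (c + y + z)
      factor = solve-∀
      edge-counted-once : ∀ e → E e * cut e + (E e * 𝟙 (e ⊆? p) + E e * 𝟙 (e ⊆? ∁ p)) ≡ E e
      edge-counted-once e = begin
        E e * cut e + (E e * 𝟙 (e ⊆? p) + E e * 𝟙 (e ⊆? ∁ p)) ≡⟨ factor (E e) (cut e) _ _ ⟩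
        E e * (cut e + 𝟙 (e ⊆? p) + 𝟙 (e ⊆? ∁ p))           ≡⟨ 𝟙-*-cong (isEdge? B e) (λ (∣e∣≡4 , _) →
                                                                 cut-trichotomy e p (0<∣p∣⇒nonempty e (≤-trans (s≤s z≤n) (≤-reflexive (sym ∣e∣≡4))))) ⟩
        E e * 1                                              ≡⟨ *-identityʳ (E e) ⟩
        E e                                                  ∎

module Binomial where

  open import Data.Nat as ℕ using (ℕ; zero; suc; _!; z≤n; s≤s; _∸_)
  import Data.Nat.Properties as ℕP
  open import Data.Nat.Combinatorics using (_C_; nCk+nC[k+1]≡[n+1]C[k+1]; nC1≡n)
  import Data.Nat.Tactic.RingSolver as ℕ-Solver
  open import Data.Integer using (ℤ; +_; -[1+_]; 0ℤ; 1ℤ; +≤+; _+_; _*_; _-_; _≤_; nonNegative)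
  import Data.Integer.Properties as ℤP
  open import Data.Integer.Tactic.RingSolver using (solve-∀)
  open import Relation.Binary.PropositionalEquality

  factorial*C-pascal : ∀ k m → + (suc k ! ℕ.* (suc m C suc k)) ≡ + suc k * + (k ! ℕ.* (m C k)) + + (suc k ! ℕ.* (m C suc k))
  factorial*C-pascal k m = begin
    + (suc k ! ℕ.* (suc m C suc k))                                ≡⟨ cong (λ c → + (suc k ! ℕ.* c)) (nCk+nC[k+1]≡[n+1]C[k+1] m k) ⟨
    + (suc k ! ℕ.* (m C k ℕ.+ m C suc k))                           ≡⟨ cong +_ (distribute (suc k) (k !) (m C k) (m C suc k)) ⟩
    + (suc k ℕ.* (k ! ℕ.* (m C k)) ℕ.+ suc k ! ℕ.* (m C suc k))    ≡⟨ ℤP.pos-+ (suc k ℕ.* (k ! ℕ.* (m C k))) _ ⟩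
    + (suc k ℕ.* (k ! ℕ.* (m C k))) + + (suc k ! ℕ.* (m C suc k))  ≡⟨ cong (_+ + (suc k ! ℕ.* (m C suc k))) (ℤP.pos-* (suc k) _) ⟩
    + suc k * + (k ! ℕ.* (m C k)) + + (suc k ! ℕ.* (m C suc k))    ∎
    where
    open ≡-Reasoning
    distribute : ∀ c f x y → c ℕ.* f ℕ.* (x ℕ.+ y) ≡ c ℕ.* (f ℕ.* x) ℕ.+ c ℕ.* f ℕ.* y
    distribute = ℕ-Solver.solve-∀

  falling₂ falling₃ falling₄ : ℤ → ℤ
  falling₂ x = x * (x - 1ℤ)
  falling₃ x = x * (x - 1ℤ) * (x - + 2)
  falling₄ x = x * (x - 1ℤ) * (x - + 2) * (x - + 3)

  1!*mC1≡m : ∀ m → + (1 ! ℕ.* (m C 1)) ≡ + m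
  1!*mC1≡m m = cong +_ (trans (ℕP.*-identityˡ (m C 1)) (nC1≡n m))

  2!*C≡falling₂ : ∀ m → + (2 ! ℕ.* (m C 2)) ≡ falling₂ (+ m)
  2!*C≡falling₂ zero    = refl
  2!*C≡falling₂ (suc m) =
    trans (factorial*C-pascal 1 m) (trans (cong₂ (λ x y → + 2 * x + y) (1!*mC1≡m m) (2!*C≡falling₂ m)) (step (+ m)))
    where step : ∀ x → + 2 * x + x * (x - 1ℤ) ≡ (1ℤ + x) * (1ℤ + x - 1ℤ)
          step = solve-∀

  3!*C≡falling₃ : ∀ m → + (3 ! ℕ.* (m C 3)) ≡ falling₃ (+ m)
  3!*C≡falling₃ zero    = refl
  3!*C≡falling₃ (suc m) =
    trans (factorial*C-pascal 2 m) (trans (cong₂ (λ x y → + 3 * x + y) (2!*C≡falling₂ m) (3!*C≡falling₃ m)) (step (+ m)))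
    where step : ∀ x → + 3 * (x * (x - 1ℤ)) + x * (x - 1ℤ) * (x - + 2) ≡ (1ℤ + x) * (1ℤ + x - 1ℤ) * (1ℤ + x - + 2)
          step = solve-∀

  4!*C≡falling₄ : ∀ m → + (4 ! ℕ.* (m C 4)) ≡ falling₄ (+ m)
  4!*C≡falling₄ zero    = refl
  4!*C≡falling₄ (suc m) =
    trans (factorial*C-pascal 3 m) (trans (cong₂ (λ x y → + 4 * x + y) (3!*C≡falling₃ m) (4!*C≡falling₄ m)) (step (+ m)))
    where step : ∀ x → + 4 * (x * (x - 1ℤ) * (x - + 2)) + x * (x - 1ℤ) * (x - + 2) * (x - + 3)
                       ≡ (1ℤ + x) * (1ℤ + x - 1ℤ) * (1ℤ + x - + 2) * (1ℤ + x - + 3)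
          step = solve-∀

  κ : ℕ → ℕ
  κ s = (s ∸ 2) ℕ.* (s ∸ 3)

  +κ≡[s-2][s-3] : ∀ {s} → 2 ℕ.≤ s → + κ s ≡ (+ s - + 2) * (+ s - + 3)
  +κ≡[s-2][s-3] {1}                 (s≤s ())
  +κ≡[s-2][s-3] {suc (suc zero)}    _ = refl
  +κ≡[s-2][s-3] {suc (suc (suc u))} _ = ℤP.pos-* (suc u) u

  12*sC4≡sC2*κ : ∀ s → 12 ℕ.* (s C 4) ≡ (s C 2) ℕ.* κ s
  12*sC4≡sC2*κ 0                 = refl
  12*sC4≡sC2*κ 1                 = refl
  12*sC4≡sC2*κ s@(suc (suc _)) = ℕP.*-cancelˡ-≡ (12 ℕ.* (s C 4)) ((s C 2) ℕ.* κ s) 2 (ℤP.+-injective (begin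
    + (2 ℕ.* (12 ℕ.* (s C 4)))              ≡⟨ cong +_ (ℕP.*-assoc 2 12 (s C 4)) ⟨
    + (4 ! ℕ.* (s C 4))                      ≡⟨ 4!*C≡falling₄ s ⟩
    falling₄ (+ s)                           ≡⟨ split (+ s) ⟩
    falling₂ (+ s) * ((+ s - + 2) * (+ s - + 3)) ≡⟨ cong₂ _*_ (2!*C≡falling₂ s) (+κ≡[s-2][s-3] {s} (s≤s (s≤s z≤n))) ⟨
    + (2 ! ℕ.* (s C 2)) * + κ s              ≡⟨ ℤP.pos-* (2 ! ℕ.* (s C 2)) (κ s) ⟨
    + (2 ℕ.* (s C 2) ℕ.* κ s)                ≡⟨ cong +_ (ℕP.*-assoc 2 (s C 2) (κ s)) ⟩
    + (2 ℕ.* ((s C 2) ℕ.* κ s))                ∎))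
    where
    open ≡-Reasoning
    split : ∀ x → x * (x - 1ℤ) * (x - + 2) * (x - + 3) ≡ x * (x - 1ℤ) * ((x - + 2) * (x - + 3))
    split = solve-∀

  0≤i*i : ∀ i → 0ℤ ≤ i * i
  0≤i*i (+ zero)  = +≤+ z≤n
  0≤i*i (+ suc m) = +≤+ z≤n
  0≤i*i -[1+ m ]  = +≤+ z≤n

  i≤i+j : ∀ {i j} → 0ℤ ≤ j → i ≤ i + j
  i≤i+j {i} {j} 0≤j = ℤP.i≤i+j i j {{nonNegative 0≤j}}

  block-identity : ∀ a b →
    + 7 * ((a + b) * (a + b - 1ℤ) * (a + b - + 2) * (a + b - + 3))
      + ((a - b) * (a - b) - + 3 * (a + b) + + 4) * ((a - b) * (a - b) - + 3 * (a + b) + + 4)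
      + (+ 12 * (a + b) - + 16)
    ≡ + 8 * (a * (a - 1ℤ) * (a - + 2) * (a - + 3) + b * (b - 1ℤ) * (b - + 2) * (b - + 3))
      + + 24 * ((a + b - + 2) * (a + b - + 3)) * (a * b)
      + + 6 * ((a + b) * (a + b - 1ℤ))
  block-identity = solve-∀

  block-bound-ℤ : ∀ a b → + 2 ≤ a + b →
    + 7 * falling₄ (a + b)
      ≤ + 8 * (falling₄ a + falling₄ b) + + 24 * ((a + b - + 2) * (a + b - + 3)) * (a * b) + + 6 * falling₂ (a + b)
  block-bound-ℤ a b 2≤a+b = begin
    + 7 * falling₄ (a + b)                                 ≤⟨ i≤i+j (0≤i*i D) ⟩
    + 7 * falling₄ (a + b) + D * D                         ≤⟨ i≤i+j (ℤP.i≤j⇒0≤j-i 16≤12[a+b]) ⟩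
    + 7 * falling₄ (a + b) + D * D + (+ 12 * (a + b) - + 16) ≡⟨ block-identity a b ⟩
    + 8 * (falling₄ a + falling₄ b) + + 24 * ((a + b - + 2) * (a + b - + 3)) * (a * b) + + 6 * falling₂ (a + b) ∎
    where
    open ℤP.≤-Reasoning
    D : ℤ
    D = (a - b) * (a - b) - + 3 * (a + b) + + 4
    16≤12[a+b] : + 16 ≤ + 12 * (a + b)
    16≤12[a+b] = ℤP.≤-trans (+≤+ (ℕP.m≤m+n 16 8)) (ℤP.*-monoˡ-≤-nonNeg (+ 12) 2≤a+b)

  block-bound : ∀ a b → 2 ℕ.≤ a ℕ.+ b →
    14 ℕ.* ((a ℕ.+ b) C 4) ℕ.≤ 16 ℕ.* (a C 4 ℕ.+ b C 4) ℕ.+ 2 ℕ.* κ (a ℕ.+ b) ℕ.* (a ℕ.* b) ℕ.+ (a ℕ.+ b) C 2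
  block-bound a b 2≤s = ℕP.*-cancelˡ-≤ 12 (ℤP.drop‿+≤+ (begin
    + (12 ℕ.* (14 ℕ.* (s C 4)))
      ≡⟨ cong +_ (lhs-scale (s C 4)) ⟩
    + (7 ℕ.* (4 ! ℕ.* (s C 4)))
      ≡⟨ ℤP.pos-* 7 (4 ! ℕ.* (s C 4)) ⟩
    + 7 * + (4 ! ℕ.* (s C 4))
      ≡⟨ cong (+ 7 *_) (trans (4!*C≡falling₄ s) (cong falling₄ +s≡)) ⟩
    + 7 * falling₄ (+ a + + b)
      ≤⟨ block-bound-ℤ (+ a) (+ b) (subst (+ 2 ≤_) +s≡ (+≤+ 2≤s)) ⟩
    + 8 * (falling₄ (+ a) + falling₄ (+ b)) + + 24 * ((+ a + + b - + 2) * (+ a + + b - + 3)) * (+ a * + b)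
      + + 6 * falling₂ (+ a + + b)
      ≡⟨ cong₂ (λ k f → + 8 * (falling₄ (+ a) + falling₄ (+ b)) + + 24 * k * (+ a * + b) + + 6 * f)
               (trans (+κ≡[s-2][s-3] 2≤s) (cong (λ x → (x - + 2) * (x - + 3)) +s≡))
               (trans (2!*C≡falling₂ s) (cong falling₂ +s≡)) ⟨
    + 8 * (falling₄ (+ a) + falling₄ (+ b)) + + 24 * + κ s * (+ a * + b) + + 6 * + (2 ! ℕ.* (s C 2))
      ≡⟨ cong₂ (λ x y → + 8 * (x + y) + + 24 * + κ s * (+ a * + b) + + 6 * + (2 ! ℕ.* (s C 2)))
               (4!*C≡falling₄ a) (4!*C≡falling₄ b) ⟨
    + 8 * (+ (4 ! ℕ.* (a C 4)) + + (4 ! ℕ.* (b C 4))) + + 24 * + κ s * (+ a * + b) + + 6 * + (2 ! ℕ.* (s C 2))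
      ≡⟨ cast (4 ! ℕ.* (a C 4)) (4 ! ℕ.* (b C 4)) (κ s) (2 ! ℕ.* (s C 2)) ⟨
    + (8 ℕ.* (4 ! ℕ.* (a C 4) ℕ.+ 4 ! ℕ.* (b C 4)) ℕ.+ 24 ℕ.* κ s ℕ.* (a ℕ.* b) ℕ.+ 6 ℕ.* (2 ! ℕ.* (s C 2)))
      ≡⟨ cong +_ (rhs-scale (a C 4) (b C 4) (κ s) (a ℕ.* b) (s C 2)) ⟨
    + (12 ℕ.* (16 ℕ.* (a C 4 ℕ.+ b C 4) ℕ.+ 2 ℕ.* κ s ℕ.* (a ℕ.* b) ℕ.+ s C 2)) ∎))
    where
    open ℤP.≤-Reasoning
    s : ℕ
    s = a ℕ.+ b
    +s≡ : + s ≡ + a + + b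
    +s≡ = ℤP.pos-+ a b
    lhs-scale : ∀ x → 12 ℕ.* (14 ℕ.* x) ≡ 7 ℕ.* (24 ℕ.* x)
    lhs-scale = ℕ-Solver.solve-∀
    rhs-scale : ∀ x y k c z → 12 ℕ.* (16 ℕ.* (x ℕ.+ y) ℕ.+ 2 ℕ.* k ℕ.* c ℕ.+ z)
                            ≡ 8 ℕ.* (24 ℕ.* x ℕ.+ 24 ℕ.* y) ℕ.+ 24 ℕ.* k ℕ.* c ℕ.+ 6 ℕ.* (2 ℕ.* z)
    rhs-scale = ℕ-Solver.solve-∀
    cast : ∀ x y k z → + (8 ℕ.* (x ℕ.+ y) ℕ.+ 24 ℕ.* k ℕ.* (a ℕ.* b) ℕ.+ 6 ℕ.* z)
                       ≡ + 8 * (+ x + + y) + + 24 * + k * (+ a * + b) + + 6 * + z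
    cast x y k z = trans (ℤP.pos-+ (8 ℕ.* (x ℕ.+ y) ℕ.+ 24 ℕ.* k ℕ.* (a ℕ.* b)) (6 ℕ.* z))
      (cong₂ _+_ (trans (ℤP.pos-+ (8 ℕ.* (x ℕ.+ y)) (24 ℕ.* k ℕ.* (a ℕ.* b)))
                        (cong₂ _+_ (trans (ℤP.pos-* 8 (x ℕ.+ y)) (cong (+ 8 *_) (ℤP.pos-+ x y)))
                                   (trans (ℤP.pos-* (24 ℕ.* k) (a ℕ.* b)) (cong₂ _*_ (ℤP.pos-* 24 k) (ℤP.pos-* a b)))))
                 (ℤP.pos-* 6 z))

  2*nC2+n≡n*n : ∀ n → 2 ℕ.* (n C 2) ℕ.+ n ≡ n ℕ.* n
  2*nC2+n≡n*n n = ℤP.+-injective (begin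
    + (2 ℕ.* (n C 2) ℕ.+ n)     ≡⟨ ℤP.pos-+ (2 ℕ.* (n C 2)) n ⟩
    + (2 ℕ.* (n C 2)) + + n     ≡⟨ cong (_+ + n) (2!*C≡falling₂ n) ⟩
    + n * (+ n - 1ℤ) + + n      ≡⟨ expand (+ n) ⟩
    + n * + n                   ≡⟨ ℤP.pos-* n n ⟨
    + (n ℕ.* n)                 ∎)
    where
    open ≡-Reasoning
    expand : ∀ x → x * (x - 1ℤ) + x ≡ x * x
    expand = solve-∀

  4mn≤[m+n]² : ∀ p q → 4 ℕ.* (p ℕ.* q) ℕ.≤ (p ℕ.+ q) ℕ.* (p ℕ.+ q)
  4mn≤[m+n]² p q = ℤP.drop‿+≤+ (begin
    + (4 ℕ.* (p ℕ.* q))                         ≡⟨ trans (ℤP.pos-* 4 (p ℕ.* q)) (cong (+ 4 *_) (ℤP.pos-* p q)) ⟩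
    + 4 * (+ p * + q)                           ≤⟨ i≤i+j (0≤i*i (+ p - + q)) ⟩
    + 4 * (+ p * + q) + (+ p - + q) * (+ p - + q) ≡⟨ square-of-sum (+ p) (+ q) ⟩
    (+ p + + q) * (+ p + + q)                   ≡⟨ trans (ℤP.pos-* (p ℕ.+ q) (p ℕ.+ q)) (cong₂ _*_ (ℤP.pos-+ p q) (ℤP.pos-+ p q)) ⟨
    + ((p ℕ.+ q) ℕ.* (p ℕ.+ q))                 ∎)
    where
    open ℤP.≤-Reasoning
    square-of-sum : ∀ x y → + 4 * (x * y) + (x - y) * (x - y) ≡ (x + y) * (x + y)
    square-of-sum = solve-∀

  κ≤s*s : ∀ s → κ s ℕ.≤ s ℕ.* s
  κ≤s*s s = ℕP.*-mono-≤ (ℕP.m∸n≤m s 2) (ℕP.m∸n≤m s 3)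

  s*s≤8κ : ∀ {s} → 4 ℕ.≤ s → s ℕ.* s ℕ.≤ 8 ℕ.* κ s
  s*s≤8κ (s≤s (s≤s (s≤s (s≤s (z≤n {u}))))) =
    subst ((4 ℕ.+ u) ℕ.* (4 ℕ.+ u) ℕ.≤_) (sym (expand u)) (ℕP.m≤m+n ((4 ℕ.+ u) ℕ.* (4 ℕ.+ u)) (u ℕ.* (7 ℕ.* u ℕ.+ 16)))
    where
    expand : ∀ u → 8 ℕ.* ((2 ℕ.+ u) ℕ.* (1 ℕ.+ u)) ≡ (4 ℕ.+ u) ℕ.* (4 ℕ.+ u) ℕ.+ u ℕ.* (7 ℕ.* u ℕ.+ 16)
    expand = ℕ-Solver.solve-∀

module SteinerSystems where

  open import Data.Nat
  open import Data.Nat.Properties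
  open import Data.Nat.Combinatorics using (_C_)
  open import Data.Nat.Tactic.RingSolver using (solve-∀)
  open import Data.Fin using (Fin)
  open import Data.Fin.Subset using (Subset; _∩_; ∁; ∣_∣)
  open import Data.List using ([]; _∷_; foldr; map)
  open import Data.Product using (proj₁; proj₂)
  open import Relation.Binary.PropositionalEquality
  open import Algebra.Properties.Semiring.Sum +-*-semiring
    using (sum-syntax; ∑-distrib-+; sum-cong-≗; *-distribˡ-sum)
  open import Algebra.Properties.CommutativeSemigroup *-commutativeSemigroup using (x∙yz≈y∙xz)
  open import Defs
  open Sums
  open Subsets
  open LinearSpaces
  open Binomial

  *-foldr-⊔-≤ : ∀ {A : Set} c {K} (f : A → ℕ) xs → (∀ x → c * f x ≤ K) → c * foldr _⊔_ 0 (map f xs) ≤ K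
  *-foldr-⊔-≤ c {K} f []       _     = subst (_≤ K) (sym (*-zeroʳ c)) z≤n
  *-foldr-⊔-≤ c {K} f (x ∷ xs) c*f≤K =
    subst (_≤ K) (sym (*-distribˡ-⊔ c (f x) _)) (⊔-lub (c*f≤K x) (*-foldr-⊔-≤ c f xs c*f≤K))

  cube-constant : ℕ → ℕ → ℕ
  cube-constant A β = suc β * suc β * suc β * (384 * A * (384 * A))

  cube-bound : ∀ {n s} m e A β → 4 * m ≤ n * n + n * s * s → s * s ≤ β * n → n ≤ s * s * A →
    n * n * s * s ≤ 384 * e → 64 * (m * m * m) ≤ cube-constant A β * (e * e)
  cube-bound {n} {s} m e A β 4m≤M s²≤βn n≤s²A n²s²≤384e = begin
    64 * (m * m * m)                                        ≡⟨ cube-scale m ⟩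
    4 * m * (4 * m) * (4 * m)                               ≤⟨ cube-mono 4m≤[1+β]n² ⟩
    suc β * (n * n) * (suc β * (n * n)) * (suc β * (n * n)) ≡⟨ regroup (suc β) n ⟩
    β³ * (n * n * n * (n * n * n))                          ≤⟨ *-monoʳ-≤ β³ (*-mono-≤ n³≤384Ae n³≤384Ae) ⟩
    β³ * (384 * A * e * (384 * A * e))                      ≡⟨ square-split β³ (384 * A) e ⟩
    β³ * (384 * A * (384 * A)) * (e * e)                    ∎
    where
    open ≤-Reasoning
    β³ : ℕ
    β³ = suc β * suc β * suc β
    cube-mono : ∀ {x y} → x ≤ y → x * x * x ≤ y * y * y
    cube-mono x≤y = *-mono-≤ (*-mono-≤ x≤y x≤y) x≤y
    cube-scale : ∀ m → 64 * (m * m * m) ≡ 4 * m * (4 * m) * (4 * m)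
    cube-scale = solve-∀
    regroup : ∀ b n → b * (n * n) * (b * (n * n)) * (b * (n * n)) ≡ b * b * b * (n * n * n * (n * n * n))
    regroup = solve-∀
    square-split : ∀ b a e → b * (a * e * (a * e)) ≡ b * (a * a) * (e * e)
    square-split = solve-∀
    4m≤[1+β]n² : 4 * m ≤ suc β * (n * n)
    4m≤[1+β]n² = ≤-trans 4m≤M (begin
      n * n + n * s * s    ≡⟨ cong (n * n +_) (*-assoc n s s) ⟩
      n * n + n * (s * s)  ≤⟨ +-monoʳ-≤ (n * n) (*-monoʳ-≤ n s²≤βn) ⟩
      n * n + n * (β * n)  ≡⟨ collect n β ⟩
      suc β * (n * n)      ∎)
      where collect : ∀ n β → n * n + n * (β * n) ≡ suc β * (n * n)
            collect = solve-∀
    n³≤384Ae : n * n * n ≤ 384 * A * e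
    n³≤384Ae = begin
      n * n * n            ≤⟨ *-monoʳ-≤ (n * n) n≤s²A ⟩
      n * n * (s * s * A)  ≡⟨ shuffle n s A ⟩
      A * (n * n * s * s)  ≤⟨ *-monoʳ-≤ A n²s²≤384e ⟩
      A * (384 * e)        ≡⟨ x∙yz≈y∙xz A 384 e ⟩
      384 * (A * e)        ≡⟨ *-assoc 384 A e ⟨
      384 * A * e          ∎
      where shuffle : ∀ n s A → n * n * (s * s * A) ≡ A * (n * n * s * s)
            shuffle = solve-∀

  module SteinerSystem {n s t} (B : Fin t → Subset n) (St : IsSteinerSystem n s t B) where

    open LinearSpace B (proj₂ St)

    ∑∣Bᵢ∣Ck≡t*sCk : ∀ k → ∑[ i < t ] (∣ B i ∣ C k) ≡ t * (s C k)
    ∑∣Bᵢ∣Ck≡t*sCk k = trans (sum-cong-≗ (λ i → cong (_C k) (proj₁ St i))) (∑-const t (s C k))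

    12*numEdges≡ : 12 * numEdges B ≡ (n C 2) * κ s
    12*numEdges≡ = begin
      12 * numEdges B          ≡⟨ cong (12 *_) (trans numEdges≡∑ (∑∣Bᵢ∣Ck≡t*sCk 4)) ⟩
      12 * (t * (s C 4))       ≡⟨ x∙yz≈y∙xz 12 t (s C 4) ⟩
      t * (12 * (s C 4))       ≡⟨ cong (t *_) (12*sC4≡sC2*κ s) ⟩
      t * ((s C 2) * κ s)      ≡⟨ *-assoc t (s C 2) (κ s) ⟨
      t * (s C 2) * κ s        ≡⟨ cong (_* κ s) (trans (sym (∑∣Bᵢ∣Ck≡t*sCk 2)) pairs-total) ⟩
      (n C 2) * κ s            ∎
      where open ≡-Reasoning

    numEdges≤n²s² : numEdges B ≤ n * n * s * s
    numEdges≤n²s² = begin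
      numEdges B             ≤⟨ m≤n*m (numEdges B) 12 ⟩
      12 * numEdges B        ≡⟨ 12*numEdges≡ ⟩
      (n C 2) * κ s          ≤⟨ *-mono-≤ C[n,2]≤n*n (κ≤s*s s) ⟩
      n * n * (s * s)        ≡⟨ *-assoc (n * n) s s ⟨
      n * n * s * s          ∎
      where
      open ≤-Reasoning
      C[n,2]≤n*n : n C 2 ≤ n * n
      C[n,2]≤n*n = ≤-trans (m≤n*m (n C 2) 2) (≤-trans (m≤m+n (2 * (n C 2)) n) (≤-reflexive (2*nC2+n≡n*n n)))

    n²s²≤384*numEdges : 2 ≤ n → 4 ≤ s → n * n * s * s ≤ 384 * numEdges B
    n²s²≤384*numEdges 2≤n 4≤s = begin
      n * n * s * s                ≡⟨ *-assoc (n * n) s s ⟩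
      n * n * (s * s)              ≤⟨ *-mono-≤ n*n≤4*C[n,2] (s*s≤8κ 4≤s) ⟩
      4 * (n C 2) * (8 * κ s)      ≡⟨ regroup (n C 2) (κ s) ⟩
      32 * ((n C 2) * κ s)         ≡⟨ cong (32 *_) 12*numEdges≡ ⟨
      32 * (12 * numEdges B)       ≡⟨ *-assoc 32 12 (numEdges B) ⟨
      384 * numEdges B             ∎
      where
      open ≤-Reasoning
      regroup : ∀ c k → 4 * c * (8 * k) ≡ 32 * (c * k)
      regroup = solve-∀
      n≤2*C[n,2] : n ≤ 2 * (n C 2)
      n≤2*C[n,2] = +-cancelʳ-≤ n n (2 * (n C 2))
        (≤-trans (≤-reflexive (cong (n +_) (sym (+-identityʳ n)))) (≤-trans (*-monoˡ-≤ n 2≤n) (≤-reflexive (sym (2*nC2+n≡n*n n)))))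
      n*n≤4*C[n,2] : n * n ≤ 4 * (n C 2)
      n*n≤4*C[n,2] = begin
        n * n                      ≡⟨ 2*nC2+n≡n*n n ⟨
        2 * (n C 2) + n            ≤⟨ +-monoʳ-≤ (2 * (n C 2)) n≤2*C[n,2] ⟩
        2 * (n C 2) + 2 * (n C 2)  ≡⟨ double (n C 2) ⟩
        4 * (n C 2)                ∎
        where double : ∀ c → 2 * c + 2 * c ≡ 4 * c
              double = solve-∀

    module _ (2≤s : 2 ≤ s) (p : Subset n) where
      private
        a b : Fin t → ℕ
        a i = ∣ B i ∩ p ∣
        b i = ∣ B i ∩ ∁ p ∣
        N X : ℕ
        N = ∑[ i < t ] (a i C 4 + b i C 4)
        X = ∑[ i < t ] (a i * b i)
        a+b≡s : ∀ i → a i + b i ≡ s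
        a+b≡s i = trans (∣p∩q∣+∣p∩∁q∣≡∣p∣ (B i) p) (proj₁ St i)

      block-sum : 14 * numEdges B ≤ 16 * N + 2 * κ s * X + n C 2
      block-sum = begin
        14 * numEdges B                                          ≡⟨ cong (14 *_) (trans numEdges≡∑ (∑∣Bᵢ∣Ck≡t*sCk 4)) ⟩
        14 * (t * (s C 4))                                       ≡⟨ x∙yz≈y∙xz 14 t (s C 4) ⟩
        t * (14 * (s C 4))                                       ≡⟨ ∑-const t (14 * (s C 4)) ⟨
        ∑[ i < t ] (14 * (s C 4))                                ≤⟨ ∑-mono-≤ block ⟩
        ∑[ i < t ] (16 * (a i C 4 + b i C 4) + 2 * κ s * (a i * b i) + s C 2)
          ≡⟨ ∑-distrib-+ (λ i → 16 * (a i C 4 + b i C 4) + 2 * κ s * (a i * b i)) (λ _ → s C 2) ⟩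
        ∑[ i < t ] (16 * (a i C 4 + b i C 4) + 2 * κ s * (a i * b i)) + ∑[ i < t ] (s C 2)
          ≡⟨ cong₂ _+_ (∑-distrib-+ (λ i → 16 * (a i C 4 + b i C 4)) (λ i → 2 * κ s * (a i * b i))) (∑-const t (s C 2)) ⟩
        ∑[ i < t ] (16 * (a i C 4 + b i C 4)) + ∑[ i < t ] (2 * κ s * (a i * b i)) + t * (s C 2)
          ≡⟨ cong₂ _+_ (cong₂ _+_ (*-distribˡ-sum 16 (λ i → a i C 4 + b i C 4))
                                  (*-distribˡ-sum (2 * κ s) (λ i → a i * b i)))
                       (trans (sym pairs-total) (∑∣Bᵢ∣Ck≡t*sCk 2)) ⟨
        16 * N + 2 * κ s * X + n C 2                             ∎
        where
        open ≤-Reasoning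
        block : ∀ i → 14 * (s C 4) ≤ 16 * (a i C 4 + b i C 4) + 2 * κ s * (a i * b i) + s C 2
        block i = subst (λ m → 14 * (m C 4) ≤ 16 * (a i C 4 + b i C 4) + 2 * κ m * (a i * b i) + m C 2) (a+b≡s i)
                        (block-bound (a i) (b i) (subst (2 ≤_) (sym (a+b≡s i)) 2≤s))

      cut-surplus : 32 * cutSize B p ≤ 28 * numEdges B + (κ s * n + 2 * (n C 2))
      cut-surplus = +-cancelʳ-≤ (28 * e) (32 * c) (28 * e + (κ s * n + 2 * C₂)) (begin
        32 * c + 28 * e                                  ≡⟨ cong (32 * c +_) (*-assoc 2 14 e) ⟩
        32 * c + 2 * (14 * e)                            ≤⟨ +-monoʳ-≤ (32 * c) (*-monoʳ-≤ 2 block-sum) ⟩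
        32 * c + 2 * (16 * N + 2 * κ s * X + C₂)         ≡⟨ regroup c N (κ s) X C₂ ⟩
        32 * (c + N) + κ s * (4 * X) + 2 * C₂            ≡⟨ cong (λ m → 32 * m + κ s * (4 * X) + 2 * C₂) (cut-decomposition p) ⟩
        32 * e + κ s * (4 * X) + 2 * C₂                  ≤⟨ +-monoˡ-≤ (2 * C₂) (+-monoʳ-≤ (32 * e) (*-monoʳ-≤ (κ s) 4X≤n*n)) ⟩
        32 * e + κ s * (n * n) + 2 * C₂                  ≡⟨ cong (λ m → 32 * e + κ s * m + 2 * C₂) (2*nC2+n≡n*n n) ⟨
        32 * e + κ s * (2 * C₂ + n) + 2 * C₂             ≡⟨ expand e (κ s) C₂ n ⟩
        32 * e + 2 * (C₂ * κ s) + κ s * n + 2 * C₂       ≡⟨ cong (λ m → 32 * e + 2 * m + κ s * n + 2 * C₂) 12*numEdges≡ ⟨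
        32 * e + 2 * (12 * e) + κ s * n + 2 * C₂         ≡⟨ collect e (κ s * n) C₂ ⟩
        28 * e + (κ s * n + 2 * C₂) + 28 * e             ∎)
        where
        open ≤-Reasoning
        c e C₂ : ℕ
        c = cutSize B p
        e = numEdges B
        C₂ = n C 2
        4X≤n*n : 4 * X ≤ n * n
        4X≤n*n = subst (λ m → 4 * X ≤ m * m) (∣p∣+∣∁p∣≡n p)
                       (subst (λ x → 4 * x ≤ _) (sym (cross-pairs p)) (4mn≤[m+n]² ∣ p ∣ ∣ ∁ p ∣))
        regroup : ∀ c N k X C → 32 * c + 2 * (16 * N + 2 * k * X + C) ≡ 32 * (c + N) + k * (4 * X) + 2 * C
        regroup = solve-∀
        expand : ∀ e k C n → 32 * e + k * (2 * C + n) + 2 * C ≡ 32 * e + 2 * (C * k) + k * n + 2 * C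
        expand = solve-∀
        collect : ∀ e r C → 32 * e + 2 * (12 * e) + r + 2 * C ≡ 28 * e + (r + 2 * C) + 28 * e
        collect = solve-∀

    maxCut-surplus : 2 ≤ s → 32 * maxCut B ≤ 28 * numEdges B + (n * n + n * s * s)
    maxCut-surplus 2≤s = *-foldr-⊔-≤ 32 (cutSize B) (allSubsets n) λ p →
      ≤-trans (cut-surplus 2≤s p) (+-monoʳ-≤ (28 * numEdges B) (begin
        κ s * n + 2 * (n C 2)    ≤⟨ +-mono-≤ (*-monoˡ-≤ n (κ≤s*s s)) (m≤m+n (2 * (n C 2)) n) ⟩
        s * s * n + (2 * (n C 2) + n) ≡⟨ cong₂ _+_ (sym (shuffle n s)) (2*nC2+n≡n*n n) ⟩
        n * s * s + n * n        ≡⟨ +-comm (n * s * s) (n * n) ⟩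
        n * n + n * s * s        ∎))
      where
      open ≤-Reasoning
      shuffle : ∀ n s → n * s * s ≡ s * s * n
      shuffle = solve-∀

module Fractions where

  open import Data.Nat as ℕ using (ℕ; suc; NonZero)
  import Data.Nat.Properties as ℕP
  open import Data.Integer as ℤ using (ℤ; +_; +[1+_]; +0; -[1+_]; +<+)
  import Data.Integer.Properties as ℤP
  open import Data.Rational using (mkℚ; 0ℚ; _/_; _≤_; _<_; ↥_; ↧ₙ_; *<*) renaming (_*_ to _·_)
  open import Data.Rational.Properties
    using (toℚᵘ-fromℚᵘ; toℚᵘ-homo-*; toℚᵘ-cancel-≤; toℚᵘ-mono-≤; toℚᵘ-injective; ↥p/↧p≡p; positive⁻¹; normalize-pos)
  open import Data.Rational.Unnormalised using (mkℚᵘ; *≤*)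
  import Data.Rational.Unnormalised.Properties as ℚᵘ
  open import Function using (_|>_)
  open import Relation.Binary.PropositionalEquality

  /-≤-/ : ∀ (i j : ℤ) m n .{{_ : NonZero m}} .{{_ : NonZero n}} → i ℤ.* + n ℤ.≤ j ℤ.* + m → i / m ≤ j / n
  /-≤-/ i j (suc m) (suc n) le = toℚᵘ-cancel-≤ (ℚᵘ.≤-respˡ-≃ (ℚᵘ.≃-sym (toℚᵘ-fromℚᵘ (mkℚᵘ i m)))
                                                (ℚᵘ.≤-respʳ-≃ (ℚᵘ.≃-sym (toℚᵘ-fromℚᵘ (mkℚᵘ j n))) (*≤* le)))

  /-≤-/⁻¹ : ∀ (i j : ℤ) m n .{{_ : NonZero m}} .{{_ : NonZero n}} → i / m ≤ j / n → i ℤ.* + n ℤ.≤ j ℤ.* + m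
  /-≤-/⁻¹ i j (suc m) (suc n) le
    with ℚᵘ.≤-respˡ-≃ (toℚᵘ-fromℚᵘ (mkℚᵘ i m)) (ℚᵘ.≤-respʳ-≃ (toℚᵘ-fromℚᵘ (mkℚᵘ j n)) (toℚᵘ-mono-≤ le))
  ... | *≤* le′ = le′

  /-*-/ : ∀ (i j : ℤ) m n .{{_ : NonZero m}} .{{_ : NonZero n}} → (i / m) · (j / n) ≡ ((i ℤ.* j) / (m ℕ.* n)) {{ℕP.m*n≢0 m n}}
  /-*-/ i j (suc m) (suc n) = toℚᵘ-injective (ℚᵘ.≃-trans (toℚᵘ-homo-* (i / suc m) (j / suc n))
    (ℚᵘ.≃-trans (ℚᵘ.*-cong (toℚᵘ-fromℚᵘ (mkℚᵘ i m)) (toℚᵘ-fromℚᵘ (mkℚᵘ j n)))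
                (ℚᵘ.≃-sym (toℚᵘ-fromℚᵘ (mkℚᵘ (i ℤ.* j) (n ℕ.+ m ℕ.* suc n))))))

  ℕ/-≤-ℕ/ : ∀ a b m n .{{_ : NonZero m}} .{{_ : NonZero n}} → a ℕ.* n ℕ.≤ b ℕ.* m → + a / m ≤ + b / n
  ℕ/-≤-ℕ/ a b m n le = /-≤-/ (+ a) (+ b) m n (subst₂ ℤ._≤_ (ℤP.pos-* a n) (ℤP.pos-* b m) (ℤ.+≤+ le))

  ℕ/-≤-ℕ/⁻¹ : ∀ a b m n .{{_ : NonZero m}} .{{_ : NonZero n}} → + a / m ≤ + b / n → a ℕ.* n ℕ.≤ b ℕ.* m
  ℕ/-≤-ℕ/⁻¹ a b m n le = ℤP.drop‿+≤+ (subst₂ ℤ._≤_ (sym (ℤP.pos-* a n)) (sym (ℤP.pos-* b m)) (/-≤-/⁻¹ (+ a) (+ b) m n le))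

  ℕ/-*-ℕ/ : ∀ a b m n .{{_ : NonZero m}} .{{_ : NonZero n}} → (+ a / m) · (+ b / n) ≡ (+ (a ℕ.* b) / (m ℕ.* n)) {{ℕP.m*n≢0 m n}}
  ℕ/-*-ℕ/ a b m n = trans (/-*-/ (+ a) (+ b) m n) (cong (λ i → (i / (m ℕ.* n)) {{ℕP.m*n≢0 m n}}) (sym (ℤP.pos-* a b)))

  0<ℕ/ : ∀ m d .{{_ : NonZero m}} .{{_ : NonZero d}} → 0ℚ < + m / d
  0<ℕ/ m d = positive⁻¹ (+ m / d) {{normalize-pos m d}}

  frac²·ℕ : ∀ k d n → (+ k / suc d) · (+ k / suc d) · (+ n / 1) ≡ + (k ℕ.* k ℕ.* n) / (suc d ℕ.* suc d ℕ.* 1)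
  frac²·ℕ k d n = trans (cong (_· (+ n / 1)) (ℕ/-*-ℕ/ k k (suc d) (suc d))) (ℕ/-*-ℕ/ (k ℕ.* k) n (suc d ℕ.* suc d) 1)

  0<p⇒[p²n≤m⇒n≤m↧²] : ∀ {p} n m → 0ℚ < p → p · p · (+ n / 1) ≤ + m / 1 → n ℕ.≤ m ℕ.* (↧ₙ p ℕ.* ↧ₙ p)
  0<p⇒[p²n≤m⇒n≤m↧²] {p@(mkℚ +[1+ k ] d _)} n m _ p²n≤m = begin
    n                                   ≤⟨ ℕP.m≤n*m n (suc k ℕ.* suc k) ⟩
    suc k ℕ.* suc k ℕ.* n               ≡⟨ ℕP.*-identityʳ _ ⟨
    suc k ℕ.* suc k ℕ.* n ℕ.* 1         ≤⟨ ℕ/-≤-ℕ/⁻¹ (suc k ℕ.* suc k ℕ.* n) m (suc d ℕ.* suc d ℕ.* 1) 1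
                                             (subst (λ q → q · q · (+ n / 1) ≤ + m / 1) (sym (↥p/↧p≡p p)) p²n≤m
                                               |> subst (_≤ + m / 1) (frac²·ℕ (suc k) d n)) ⟩
    m ℕ.* (suc d ℕ.* suc d ℕ.* 1)       ≡⟨ cong (m ℕ.*_) (ℕP.*-identityʳ _) ⟩
    m ℕ.* (suc d ℕ.* suc d)             ∎
    where open ℕP.≤-Reasoning
  0<p⇒[p²n≤m⇒n≤m↧²] {mkℚ +0       _ _} _ _ (*<* (+<+ ()))
  0<p⇒[p²n≤m⇒n≤m↧²] {mkℚ -[1+ _ ] _ _} _ _ (*<* ())

  0<p⇒[m≤p²n⇒m≤↥²n] : ∀ {p} n m → 0ℚ < p → + m / 1 ≤ p · p · (+ n / 1) →
                      m ℕ.≤ ℤ.∣ ↥ p ∣ ℕ.* ℤ.∣ ↥ p ∣ ℕ.* n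
  0<p⇒[m≤p²n⇒m≤↥²n] {p@(mkℚ +[1+ k ] d _)} n m _ m≤p²n = begin
    m                                   ≤⟨ ℕP.m≤m*n m (suc d ℕ.* suc d ℕ.* 1) ⟩
    m ℕ.* (suc d ℕ.* suc d ℕ.* 1)       ≤⟨ ℕ/-≤-ℕ/⁻¹ m (suc k ℕ.* suc k ℕ.* n) 1 (suc d ℕ.* suc d ℕ.* 1)
                                             (subst (λ q → + m / 1 ≤ q · q · (+ n / 1)) (sym (↥p/↧p≡p p)) m≤p²n
                                               |> subst (+ m / 1 ≤_) (frac²·ℕ (suc k) d n)) ⟩
    suc k ℕ.* suc k ℕ.* n ℕ.* 1         ≡⟨ ℕP.*-identityʳ _ ⟩
    suc k ℕ.* suc k ℕ.* n               ∎
    where open ℕP.≤-Reasoning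
  0<p⇒[m≤p²n⇒m≤↥²n] {mkℚ +0       _ _} _ _ (*<* (+<+ ()))
  0<p⇒[m≤p²n⇒m≤↥²n] {mkℚ -[1+ _ ] _ _} _ _ (*<* ())

module Asymptotics where

  open import Data.Nat as ℕ using (ℕ; suc)
  import Data.Nat.Properties as ℕP
  import Data.Nat.Tactic.RingSolver as ℕ-Solver
  open import Data.Integer as ℤ using (ℤ; +_; -[1+_]; +≤+; -≤+)
  import Data.Integer.Properties as ℤP
  open import Data.Integer.Tactic.RingSolver using (solve-∀)
  open import Data.Rational using (_/_; _≤_) renaming (_*_ to _·_)
  import Data.Rational.Properties as ℚP
  open import Data.Fin using (Fin)
  open import Data.Fin.Subset using (Subset)
  open import Relation.Binary.PropositionalEquality
  open import Defs
  open SteinerSystems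
  open Fractions

  surplus-numerator : ∀ {c e M} → 32 ℕ.* c ℕ.≤ 28 ℕ.* e ℕ.+ M → + 4 ℤ.* (+ (8 ℕ.* c) ℤ.- + (7 ℕ.* e)) ℤ.≤ + M
  surplus-numerator {c} {e} {M} le = begin
    + 4 ℤ.* (+ (8 ℕ.* c) ℤ.- + (7 ℕ.* e))              ≡⟨ distrib (+ (8 ℕ.* c)) (+ (7 ℕ.* e)) ⟩
    + 4 ℤ.* + (8 ℕ.* c) ℤ.- + 4 ℤ.* + (7 ℕ.* e)         ≡⟨ cong₂ ℤ._-_ (ℤP.pos-* 4 (8 ℕ.* c)) (ℤP.pos-* 4 (7 ℕ.* e)) ⟨
    + (4 ℕ.* (8 ℕ.* c)) ℤ.- + (4 ℕ.* (7 ℕ.* e))         ≡⟨ cong₂ (λ x y → + x ℤ.- + y) (ℕP.*-assoc 4 8 c) (ℕP.*-assoc 4 7 e) ⟨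
    + (32 ℕ.* c) ℤ.- + (28 ℕ.* e)                        ≤⟨ ℤP.+-monoˡ-≤ (ℤ.- + (28 ℕ.* e)) (+≤+ le) ⟩
    + (28 ℕ.* e ℕ.+ M) ℤ.- + (28 ℕ.* e)                  ≡⟨ cong (ℤ._- + (28 ℕ.* e)) (ℤP.pos-+ (28 ℕ.* e) M) ⟩
    + (28 ℕ.* e) ℤ.+ + M ℤ.- + (28 ℕ.* e)                ≡⟨ cancel (+ (28 ℕ.* e)) (+ M) ⟩
    + M                                                  ∎
    where
    open ℤP.≤-Reasoning
    distrib : ∀ x y → + 4 ℤ.* (x ℤ.- y) ≡ + 4 ℤ.* x ℤ.- + 4 ℤ.* y
    distrib = solve-∀
    cancel : ∀ x y → x ℤ.+ y ℤ.- x ≡ y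
    cancel = solve-∀

  cube-≤ : ∀ {x L} → (∀ {m} → x ≡ + m → m ℕ.* m ℕ.* m ℕ.≤ L) → x ℤ.* x ℤ.* x ℤ.* + 1 ℤ.≤ + L
  cube-≤ {+ m}      m³≤L = subst (ℤ._≤ _) (sym (cast m)) (+≤+ (m³≤L refl))
    where cast : ∀ m → + m ℤ.* + m ℤ.* + m ℤ.* + 1 ≡ + (m ℕ.* m ℕ.* m)
          cast m = trans (ℤP.*-identityʳ _) (trans (cong (ℤ._* + m) (sym (ℤP.pos-* m m))) (sym (ℤP.pos-* (m ℕ.* m) m)))
  cube-≤ { -[1+ m ]} _ = -≤+

  module RationalBounds {n s t} {B : Fin t → Subset n} (St : IsSteinerSystem n s t B) where

    open SteinerSystem B St
    open ℚP.≤-Reasoning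

    private
      X M : ℕ
      X = n ℕ.* n ℕ.* s ℕ.* s
      M = n ℕ.* n ℕ.+ n ℕ.* s ℕ.* s
      x : ℤ
      x = + (8 ℕ.* maxCut B) ℤ.- + (7 ℕ.* numEdges B)
      4x≤M : 2 ℕ.≤ s → + 4 ℤ.* x ℤ.≤ + M
      4x≤M 2≤s = surplus-numerator {maxCut B} {numEdges B} {M} (maxCut-surplus 2≤s)
      unit : ∀ x → 1 ℕ.* x ℕ.* 1 ≡ x
      unit = ℕ-Solver.solve-∀

    numEdges-lower : 2 ℕ.≤ n → 4 ℕ.≤ s → + 1 / 384 · (+ (n ℕ.* n ℕ.* s ℕ.* s) / 1) ≤ + numEdges B / 1
    numEdges-lower 2≤n 4≤s = begin
      + 1 / 384 · (+ X / 1)    ≡⟨ ℕ/-*-ℕ/ 1 X 384 1 ⟩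
      + (1 ℕ.* X) / 384        ≤⟨ ℕ/-≤-ℕ/ (1 ℕ.* X) (numEdges B) 384 1 (ℕP.≤-trans (ℕP.≤-reflexive (unit X))
                                    (ℕP.≤-trans (n²s²≤384*numEdges 2≤n 4≤s) (ℕP.≤-reflexive (ℕP.*-comm 384 (numEdges B))))) ⟩
      + numEdges B / 1         ∎

    numEdges-upper : + numEdges B / 1 ≤ + 1 / 1 · (+ (n ℕ.* n ℕ.* s ℕ.* s) / 1)
    numEdges-upper = begin
      + numEdges B / 1         ≤⟨ ℕ/-≤-ℕ/ (numEdges B) (1 ℕ.* X) 1 1 (ℕP.≤-trans (ℕP.≤-reflexive (ℕP.*-identityʳ (numEdges B)))
                                    (ℕP.≤-trans numEdges≤n²s² (ℕP.≤-reflexive (sym (unit X))))) ⟩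
      + (1 ℕ.* X) / 1          ≡⟨ ℕ/-*-ℕ/ 1 X 1 1 ⟨
      + 1 / 1 · (+ X / 1)      ∎

    surp≤ : 2 ℕ.≤ s → surp B ≤ + 1 / 32 · (+ (n ℕ.* n ℕ.+ n ℕ.* s ℕ.* s) / 1)
    surp≤ 2≤s = begin
      surp B                 ≤⟨ /-≤-/ x (+ (1 ℕ.* M)) 8 32 32x≤8M ⟩
      + (1 ℕ.* M) / 32       ≡⟨ ℕ/-*-ℕ/ 1 M 32 1 ⟨
      + 1 / 32 · (+ M / 1)   ∎
      where
      scale : ∀ x → + 4 ℤ.* x ℤ.* + 8 ≡ x ℤ.* + 32
      scale = solve-∀
      32x≤8M : x ℤ.* + 32 ℤ.≤ + (1 ℕ.* M) ℤ.* + 8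
      32x≤8M = subst₂ ℤ._≤_ (scale x) (cong (λ y → + y ℤ.* + 8) (sym (ℕP.*-identityˡ M)))
                      (ℤP.*-monoʳ-≤-nonNeg (+ 8) (4x≤M 2≤s))

    surp³≤ : ∀ A β → 4 ℕ.≤ s → 2 ℕ.≤ n → s ℕ.* s ℕ.≤ β ℕ.* n → n ℕ.≤ s ℕ.* s ℕ.* A →
      surp B · surp B · surp B ≤ + cube-constant A β / 1 · (+ (numEdges B ℕ.* numEdges B) / 1)
    surp³≤ A β 4≤s 2≤n s²≤βn n≤s²A = begin
      surp B · surp B · surp B      ≡⟨ trans (cong (_· surp B) (/-*-/ x x 8 8)) (/-*-/ (x ℤ.* x) x 64 8) ⟩
      (x ℤ.* x ℤ.* x) / 512         ≤⟨ /-≤-/ (x ℤ.* x ℤ.* x) (+ (K ℕ.* e²)) 512 1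
                                         (subst (x ℤ.* x ℤ.* x ℤ.* + 1 ℤ.≤_) (ℤP.pos-* (K ℕ.* e²) 512) (cube-≤ {x} m³≤)) ⟩
      + (K ℕ.* e²) / 1              ≡⟨ ℕ/-*-ℕ/ K e² 1 1 ⟨
      + K / 1 · (+ e² / 1)          ∎
      where
      K e² : ℕ
      K = cube-constant A β
      e² = numEdges B ℕ.* numEdges B
      m³≤ : ∀ {m} → x ≡ + m → m ℕ.* m ℕ.* m ℕ.≤ K ℕ.* e² ℕ.* 512
      m³≤ {m} x≡m = ℕP.≤-trans (ℕP.m≤n*m _ 64) (ℕP.≤-trans
        (cube-bound m (numEdges B) A β 4m≤M s²≤βn n≤s²A (n²s²≤384*numEdges 2≤n 4≤s)) (ℕP.m≤m*n _ 512))
        where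
        4m≤M : 4 ℕ.* m ℕ.≤ M
        4m≤M = ℤP.drop‿+≤+ (subst (ℤ._≤ + M) (trans (cong (+ 4 ℤ.*_) x≡m) (sym (ℤP.pos-* 4 m)))
                                  (4x≤M (ℕP.≤-trans (ℕP.m≤m+n 2 2) 4≤s)))

open import Defs
open import Data.Nat using (ℕ; _≤_; _+_; _*_)
open import Data.Rational using (ℚ; 0ℚ; _<_; _/_) renaming (_≤_ to _≤ℚ_; _*_ to _·_)
open import Data.Fin using (Fin)
open import Data.Fin.Subset using (Subset)
open import Data.Product using (_×_; Σ; ∃)
open import Data.Integer using (+_)

open import Data.Nat.Properties using (≤-trans; m≤m+n)
open import Data.Integer using (∣_∣)
open import Data.Product using (_,_)
open import Data.Rational using (↥_; ↧ₙ_)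
open Fractions using (0<ℕ/; 0<p⇒[p²n≤m⇒n≤m↧²]; 0<p⇒[m≤p²n⇒m≤↥²n])
open SteinerSystems using (cube-constant)
open Asymptotics.RationalBounds

proposition1p7 :
  -- e(G) = Θ(n²s²)
  (Σ ℚ λ c → Σ ℚ λ C → Σ ℕ λ N → (0ℚ < c) × (0ℚ < C) ×
    (∀ n s t (B : Fin t → Subset n) → 4 ≤ s → N ≤ n → IsSteinerSystem n s t B →
      (c · ((+ (n * n * s * s)) / 1) ≤ℚ (+ numEdges B) / 1) ×
      ((+ numEdges B) / 1 ≤ℚ C · ((+ (n * n * s * s)) / 1))))
  ×
  -- surp(G) = O(n² + ns²)
  (Σ ℚ λ C → Σ ℕ λ N → (0ℚ < C) ×
    (∀ n s t (B : Fin t → Subset n) → 4 ≤ s → N ≤ n → IsSteinerSystem n s t B →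
      surp B ≤ℚ C · ((+ (n * n + n * s * s)) / 1)))
  ×
  -- if s = Θ(√n), i.e. a√n ≤ s ≤ b√n (equivalently a²n ≤ s² ≤ b²n), then
  -- surp(G) = O(e(G)^{2/3}), i.e. surp(G)³ ≤ C·e(G)² (surp(G) ≥ 0 always)
  ((a b : ℚ) → 0ℚ < a → 0ℚ < b →
    Σ ℚ λ C → Σ ℕ λ N → (0ℚ < C) ×
    (∀ n s t (B : Fin t → Subset n) → 4 ≤ s → N ≤ n → IsSteinerSystem n s t B →
      a · a · ((+ n) / 1) ≤ℚ (+ (s * s)) / 1 →
      (+ (s * s)) / 1 ≤ℚ b · b · ((+ n) / 1) →
      surp B · surp B · surp B ≤ℚ C · ((+ (numEdges B * numEdges B)) / 1)))
proposition1p7 =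
    (+ 1 / 384 , + 1 / 1 , 2 , 0<ℕ/ 1 384 , 0<ℕ/ 1 1 ,
       λ n s t B 4≤s 2≤n St → numEdges-lower St 2≤n 4≤s , numEdges-upper St)
  , (+ 1 / 32 , 0 , 0<ℕ/ 1 32 , λ n s t B 4≤s _ St → surp≤ St (≤-trans (m≤m+n 2 2) 4≤s))
  , λ a b 0<a 0<b →
      + cube-constant (den² a) (num² b) / 1 , 2 , 0<ℕ/ (cube-constant (den² a) (num² b)) 1 ,
      λ n s t B 4≤s 2≤n St a²n≤s² s²≤b²n →
        surp³≤ St (den² a) (num² b) 4≤s 2≤n (0<p⇒[m≤p²n⇒m≤↥²n] n (s * s) 0<b s²≤b²n)
          (0<p⇒[p²n≤m⇒n≤m↧²] n (s * s) 0<a a²n≤s²)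
  where
  den² num² : ℚ → ℕ
  den² q = ↧ₙ q * ↧ₙ q
  num² q = ∣ ↥ q ∣ * ∣ ↥ q ∣
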